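{- Let $p,q\in\mathbb{N}_0$, let $a_1,\dots,a_p,b_1,\dots,b_q$ be complex numbers with no $b_s$ equal to zero or a negative integer, let $k\in\mathbb{N}$ and $m\in\mathbb{N}_0$. For $n\in\mathbb{N}_0$ let $$A_n^{(k)}(m,x)=x^n\sum_{i=0}^{\lfloor n/k\rfloor}\frac{\prod_{r=1}^p (a_r)^{(i)}}{\prod_{s=1}^q (b_s)^{(i)}}\prod_{j=1}^k\left(-\frac{n-j+1}{k}\right)^{(i)}\frac{m^i}{i!\,x^{ki}},$$ which is a polynomial in $x$ (this is $x^n\,{}_{k+p}F_q\big[a_1,\dots,a_p,-\tfrac{n}{k},-\tfrac{n-1}{k},\dots,-\tfrac{n-k+1}{k};\,b_1,\dots,b_q\,\big|\,\tfrac{m}{x^k}\big]$). Then the sequence $\{A_n^{(k)}(m,x)\}_{n\ge 0}$ is an Appell-type polynomial sequence, i.e. there is a formal power series $A(t)=\sum_{j\ge0}\alpha_j t^j/j!$ with $\alpha_0\neq 0$ such that $$A(t)e^{xt}=\sum_{n=0}^{\infty}A_n^{(k)}(m,x)\frac{t^n}{n!}.$$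
   Context: $x^{(n)}$ denotes the rising factorial (Pochhammer symbol): $x^{(0)}=1$, $x^{(n)}=x(x+1)\cdots(x+n-1)$ for $n\ge1$. An empty product equals $1$. The generalized hypergeometric function is ${}_pF_q[a_1,\dots,a_p;b_1,\dots,b_q\,|\,z]=\sum_{i\ge0}\frac{\prod_r a_r^{(i)}}{\prod_s b_s^{(i)}}\frac{z^i}{i!}$. A polynomial sequence $\{A_n(x)\}$ is called of Appell type if its exponential generating function has the form $A(t)e^{xt}$ for a formal power series $A(t)$ with nonzero constant term (equivalently $\deg A_n=n$ and $A_n'(x)=nA_{n-1}(x)$). -}

module Defs where

open import Level using (Level; _⊔_) renaming (suc to lsuc)
open import Data.Nat using (ℕ; zero; suc; _∸_; _/_; NonZero)
import Data.Nat as ℕ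
open import Data.Nat.Combinatorics using (_C_)
open import Data.Vec using (Vec; foldr; map)
open import Relation.Nullary using (¬_)
open import Algebra.Bundles using (CommutativeRing)

cast : ∀ {c ℓ} (R : CommutativeRing c ℓ) → ℕ → CommutativeRing.Carrier R
cast R zero = CommutativeRing.0# R
cast R (suc n) = CommutativeRing._+_ R (CommutativeRing.1# R) (cast R n)

-- A field of characteristic zero, presented with a total inverse
-- (the value 0 ⁻¹ is unspecified and never used in a meaningful way).
record CharZeroField (c ℓ : Level) : Set (lsuc (c ⊔ ℓ)) where
  field
    commutativeRing : CommutativeRing c ℓ
  open CommutativeRing commutativeRing public
  field
    _⁻¹        : Carrier → Carrier
    ⁻¹-inverse : ∀ x → ¬ (x ≈ 0#) → x * (x ⁻¹) ≈ 1#
    char-zero  : ∀ n → ¬ (cast commutativeRing (suc n) ≈ 0#)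

module FieldOps {c ℓ} (F : CharZeroField c ℓ) where
  open CharZeroField F

  ι : ℕ → Carrier
  ι = cast commutativeRing

  _÷_ : Carrier → Carrier → Carrier
  a ÷ b = a * (b ⁻¹)

  pow : Carrier → ℕ → Carrier
  pow x zero = 1#
  pow x (suc n) = pow x n * x

  rising : Carrier → ℕ → Carrier
  rising x zero = 1#
  rising x (suc n) = rising x n * (x + ι n)

  sumTo : ℕ → (ℕ → Carrier) → Carrier
  sumTo zero f = f 0
  sumTo (suc n) f = sumTo n f + f (suc n)

  prod1to : ℕ → (ℕ → Carrier) → Carrier
  prod1to zero f = 1#
  prod1to (suc k) f = prod1to k f * f (suc k)

  prodVec : ∀ {p} → Vec Carrier p → Carrier
  prodVec = foldr _ _*_ 1#

  -- A_n^{(k)}(m,x), written as the polynomial it is: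
  --   Σ_{i=0}^{⌊n/k⌋} (Π_r (a_r)^{(i)} / Π_s (b_s)^{(i)})
  --        · Π_{j=1}^{k} (-(n-j+1)/k)^{(i)} · m^i / i! · x^{n-ki}
  -- (since k i ≤ n, x^n · x^{-ki} = x^{n-ki}).
  A : ∀ {p q} → Vec Carrier p → Vec Carrier q →
      (k : ℕ) → .{{_ : NonZero k}} → (m n : ℕ) → Carrier → Carrier
  A as bs k m n x =
    sumTo (n / k) λ i →
      ((prodVec (map (λ a → rising a i) as)
          ÷ prodVec (map (λ b → rising b i) bs))
        * prod1to k (λ j → rising (- ((ι (suc n) - ι j) ÷ ι k)) i))
        * ((pow (ι m) i ÷ ι (i ℕ.!)) * pow x (n ∸ k ℕ.* i))

  -- Σ_{j=0}^{n} C(n,j) α_j x^{n-j}: the coefficient of t^n/n! in A(t) e^{xt}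
  -- where A(t) = Σ_j α_j t^j / j!.
  appellCoeff : (ℕ → Carrier) → ℕ → Carrier → Carrier
  appellCoeff α n x = sumTo n λ j → (ι (n C j) * α j) * pow x (n ∸ j)

module Submission where

-- Write γ = -1/k.  The k upper parameters -(n-j+1)/k, j = 1..k, of the
-- hypergeometric series interlace: raising the j-th one by l gives
-- γ·(n+1 - (lk+j)).  Hence the product over j of their rising factorials
-- of length i is γ^{ki} times the falling factorial n(n-1)…(n-ki+1),
-- which equals C(n,ki)·(ki)!.  So the i-th term of A_n^{(k)}(m,x) is
--   C(n,ki) · β_i · x^{n-ki},
-- where β_i is the same expression with n replaced by ki, i.e. it no
-- longer depends on n.  Putting α_{ki} = β_i and α_j = 0 for k ∤ j, the
-- Appell sum Σ_j C(n,j) α_j x^{n-j} collapses onto the multiples of k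
-- and reproduces A_n^{(k)}(m,x); finally α_0 = β_0 = 1 ≠ 0.

open import Defs
open import Data.Nat using (ℕ; NonZero)
open import Data.Fin using (Fin)
open import Data.Vec using (Vec; lookup)
open import Data.Product using (Σ; _×_; _,_)
open import Relation.Nullary using (¬_)

open import Data.Nat as ℕ using (zero; suc; _∸_; _/_; _%_; _!)
import Data.Nat.Properties as ℕ
open import Data.Nat.Combinatorics using (_C_)
open import Data.Vec using ([]; _∷_; map)
open import Relation.Binary.PropositionalEquality as ≡ using (_≡_; cong; cong₂)
open import Algebra.Bundles using (CommutativeRing)

module FallingFactorial where
  open import Data.Nat
  open import Data.Nat.Properties
  open import Data.Nat.DivMod using (m/n*n≡m)
  open import Data.Nat.Combinatorics using (nCk≡nPk/k!)
  open import Data.Nat.Combinatorics.Base using (_P′_; _P_)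
  open import Data.Nat.Combinatorics.Specification using (k!∣nP′k; k>n⇒nCk≡0)
  open import Data.Bool using (true)
  open import Data.Sum using (inj₁; inj₂)
  open import Relation.Nullary using (yes; no)
  open ≡ using (refl; sym)

  -- n(n-1)…(n-N+1) contains the factor 0 once N exceeds n.
  falling-vanishes : ∀ n N → n < N → n P′ N ≡ 0
  falling-vanishes n (suc N) (s≤s n≤N) with m≤n⇒m<n∨m≡n n≤N
  ... | inj₁ n<N rewrite falling-vanishes n N n<N = *-zeroʳ (n ∸ N)
  ... | inj₂ refl rewrite n∸n≡0 n = refl

  P≡P′ : ∀ n N → N ≤ n → n P N ≡ n P′ N
  P≡P′ n N N≤n with N ≤ᵇ n | ≤⇒≤ᵇ N≤n
  ... | true | _ = refl

  falling≡binomial*factorial : ∀ n N → n P′ N ≡ (n C N) * N !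
  falling≡binomial*factorial n N with N ≤? n
  ... | yes N≤n = begin
    n P′ N                 ≡⟨ sym (m/n*n≡m (k!∣nP′k N≤n)) ⟩
    (n P′ N) / N ! * N !   ≡⟨ cong (λ z → z / N ! * N !) (sym (P≡P′ n N N≤n)) ⟩
    (n P N) / N ! * N !    ≡⟨ cong (_* N !) (sym (nCk≡nPk/k! N≤n)) ⟩
    (n C N) * N !          ∎
    where open ≡.≡-Reasoning
          instance _ = N !≢0
  ... | no N≰n rewrite k>n⇒nCk≡0 (≰⇒> N≰n) = falling-vanishes n N (≰⇒> N≰n)

open FallingFactorial using (falling-vanishes; falling≡binomial*factorial)
open import Data.Nat.Combinatorics.Base using (_P′_)

module CastHomomorphism {c ℓ} (R : CommutativeRing c ℓ) where
  open CommutativeRing R hiding (zero)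
  open import Algebra.Properties.Monoid.Mult +-monoid using (×-homo-+) renaming (_×_ to _·_)
  open import Algebra.Properties.Semiring.Mult semiring using (×1-homo-*)
  open import Algebra.Properties.AbelianGroup +-abelianGroup using (xyx⁻¹≈y)
  open import Relation.Binary.Reasoning.Setoid setoid

  cast≈×1 : ∀ n → cast R n ≈ n · 1#
  cast≈×1 zero    = refl
  cast≈×1 (suc n) = +-congˡ (cast≈×1 n)

  cast-+ : ∀ m n → cast R (m ℕ.+ n) ≈ cast R m + cast R n
  cast-+ m n = begin
    cast R (m ℕ.+ n)       ≈⟨ cast≈×1 (m ℕ.+ n) ⟩
    (m ℕ.+ n) · 1#         ≈⟨ ×-homo-+ 1# m n ⟩
    m · 1# + n · 1#        ≈⟨ +-cong (cast≈×1 m) (cast≈×1 n) ⟨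
    cast R m + cast R n    ∎

  cast-* : ∀ m n → cast R (m ℕ.* n) ≈ cast R m * cast R n
  cast-* m n = begin
    cast R (m ℕ.* n)       ≈⟨ cast≈×1 (m ℕ.* n) ⟩
    (m ℕ.* n) · 1#         ≈⟨ ×1-homo-* m n ⟩
    (m · 1#) * (n · 1#)    ≈⟨ *-cong (cast≈×1 m) (cast≈×1 n) ⟨
    cast R m * cast R n    ∎

  cast-∸ : ∀ n N → N ℕ.≤ n → cast R (suc n) - cast R (suc N) ≈ cast R (n ∸ N)
  cast-∸ n N N≤n = begin
    cast R (suc n) - cast R (suc N)
      ≈⟨ +-congʳ (reflexive (cong (λ z → cast R (suc z)) (≡.sym (ℕ.m+[n∸m]≡n N≤n)))) ⟩
    cast R (suc N ℕ.+ (n ∸ N)) - cast R (suc N)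
      ≈⟨ +-congʳ (cast-+ (suc N) (n ∸ N)) ⟩
    cast R (suc N) + cast R (n ∸ N) - cast R (suc N)
      ≈⟨ xyx⁻¹≈y (cast R (suc N)) (cast R (n ∸ N)) ⟩
    cast R (n ∸ N) ∎

module Development {c ℓ} (F : CharZeroField c ℓ) where
  open CharZeroField F hiding (zero)
  open FieldOps F
  open CastHomomorphism commutativeRing
  open import Relation.Binary.Reasoning.Setoid setoid
  open import Algebra.Properties.CommutativeSemigroup *-commutativeSemigroup using (interchange)
  open import Relation.Nullary using (yes; no)

  prodBelow : ℕ → (ℕ → Carrier) → Carrier
  prodBelow zero    f = 1#
  prodBelow (suc i) f = prodBelow i f * f i

  prodBelow-cong : ∀ i {f g} → (∀ l → f l ≈ g l) → prodBelow i f ≈ prodBelow i g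
  prodBelow-cong zero    f≈g = refl
  prodBelow-cong (suc i) f≈g = *-cong (prodBelow-cong i f≈g) (f≈g i)

  prod1to-cong : ∀ k {f g} → (∀ j → f j ≈ g j) → prod1to k f ≈ prod1to k g
  prod1to-cong zero    f≈g = refl
  prod1to-cong (suc k) f≈g = *-cong (prod1to-cong k f≈g) (f≈g (suc k))

  prodBelow-* : ∀ i f g → prodBelow i (λ l → f l * g l) ≈ prodBelow i f * prodBelow i g
  prodBelow-* zero    f g = sym (*-identityˡ 1#)
  prodBelow-* (suc i) f g = trans (*-congʳ (prodBelow-* i f g)) (interchange _ _ _ _)

  prod1to-* : ∀ k f g → prod1to k (λ j → f j * g j) ≈ prod1to k f * prod1to k g
  prod1to-* zero    f g = sym (*-identityˡ 1#)
  prod1to-* (suc k) f g = trans (*-congʳ (prod1to-* k f g)) (interchange _ _ _ _)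

  prod1to-1 : ∀ k → prod1to k (λ _ → 1#) ≈ 1#
  prod1to-1 zero    = refl
  prod1to-1 (suc k) = trans (*-identityʳ _) (prod1to-1 k)

  prod-interchange : ∀ k i (h : ℕ → ℕ → Carrier) →
    prod1to k (λ j → prodBelow i (h j)) ≈ prodBelow i (λ l → prod1to k (λ j → h j l))
  prod-interchange k zero    h = prod1to-1 k
  prod-interchange k (suc i) h =
    trans (prod1to-* k _ _) (*-congʳ (prod-interchange k i h))

  prod1to-+ : ∀ a b f → prod1to (a ℕ.+ b) f ≈ prod1to a f * prod1to b (λ j → f (a ℕ.+ j))
  prod1to-+ a zero f =
    trans (reflexive (cong (λ z → prod1to z f) (ℕ.+-identityʳ a))) (sym (*-identityʳ _))
  prod1to-+ a (suc b) f = begin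
    prod1to (a ℕ.+ suc b) f
      ≈⟨ reflexive (cong (λ z → prod1to z f) (ℕ.+-suc a b)) ⟩
    prod1to (a ℕ.+ b) f * f (suc (a ℕ.+ b))
      ≈⟨ *-cong (prod1to-+ a b f) (reflexive (cong f (≡.sym (ℕ.+-suc a b)))) ⟩
    prod1to a f * prod1to b (λ j → f (a ℕ.+ j)) * f (a ℕ.+ suc b)
      ≈⟨ *-assoc _ _ _ ⟩
    prod1to a f * prod1to (suc b) (λ j → f (a ℕ.+ j)) ∎

  prod-blocks : ∀ k i H →
    prodBelow i (λ l → prod1to k (λ j → H (l ℕ.* k ℕ.+ j))) ≈ prod1to (i ℕ.* k) H
  prod-blocks k zero    H = refl
  prod-blocks k (suc i) H = begin
    prodBelow i (λ l → prod1to k (λ j → H (l ℕ.* k ℕ.+ j))) * prod1to k (λ j → H (i ℕ.* k ℕ.+ j))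
      ≈⟨ *-congʳ (prod-blocks k i H) ⟩
    prod1to (i ℕ.* k) H * prod1to k (λ j → H (i ℕ.* k ℕ.+ j))
      ≈⟨ prod1to-+ (i ℕ.* k) k H ⟨
    prod1to (i ℕ.* k ℕ.+ k) H
      ≈⟨ reflexive (cong (λ z → prod1to z H) (ℕ.+-comm (i ℕ.* k) k)) ⟩
    prod1to (suc i ℕ.* k) H ∎

  rising≈prodBelow : ∀ x i → rising x i ≈ prodBelow i (λ l → x + ι l)
  rising≈prodBelow x zero    = refl
  rising≈prodBelow x (suc i) = *-congʳ (rising≈prodBelow x i)

  sumTo-cong : ∀ n {f g} → (∀ i → f i ≈ g i) → sumTo n f ≈ sumTo n g
  sumTo-cong zero    f≈g = f≈g 0
  sumTo-cong (suc n) f≈g = +-cong (sumTo-cong n f≈g) (f≈g (suc n))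

  module SparseSum (k' : ℕ) (G : ℕ → Carrier)
                   (G-off : ∀ j r → j % suc k' ≡ suc r → G j ≈ 0#) where
    k : ℕ
    k = suc k'

    -- Terms qk+1, …, qk+r with r < k lie off the multiples of k.
    sum-tail : ∀ q r → r ℕ.< k → sumTo (q ℕ.* k ℕ.+ r) G ≈ sumTo (q ℕ.* k) G
    sum-tail q zero    _   = reflexive (cong (λ z → sumTo z G) (ℕ.+-identityʳ (q ℕ.* k)))
    sum-tail q (suc r) r<k = begin
      sumTo (q ℕ.* k ℕ.+ suc r) G
        ≈⟨ reflexive (cong (λ z → sumTo z G) (ℕ.+-suc _ r)) ⟩
      sumTo (q ℕ.* k ℕ.+ r) G + G (suc (q ℕ.* k ℕ.+ r))
        ≈⟨ +-cong (sum-tail q r (ℕ.<-trans (ℕ.n<1+n r) r<k)) (G-off _ r residue) ⟩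
      sumTo (q ℕ.* k) G + 0#
        ≈⟨ +-identityʳ _ ⟩
      sumTo (q ℕ.* k) G ∎
      where
      open import Data.Nat.DivMod using ([m+kn]%n≡m%n; m<n⇒m%n≡m)
      residue : suc (q ℕ.* k ℕ.+ r) % k ≡ suc r
      residue = ≡.trans (cong (λ z → suc z % k) (ℕ.+-comm (q ℕ.* k) r))
                  (≡.trans ([m+kn]%n≡m%n (suc r) q k) (m<n⇒m%n≡m r<k))

    sum-multiples : ∀ q → sumTo (q ℕ.* k) G ≈ sumTo q (λ i → G (k ℕ.* i))
    sum-multiples zero    = reflexive (cong G (≡.sym (ℕ.*-zeroʳ k)))
    sum-multiples (suc q) = +-cong (begin
        sumTo (k' ℕ.+ q ℕ.* k) G
          ≈⟨ reflexive (cong (λ z → sumTo z G) (ℕ.+-comm k' (q ℕ.* k))) ⟩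
        sumTo (q ℕ.* k ℕ.+ k') G
          ≈⟨ sum-tail q k' (ℕ.n<1+n k') ⟩
        sumTo (q ℕ.* k) G
          ≈⟨ sum-multiples q ⟩
        sumTo q (λ i → G (k ℕ.* i)) ∎)
      (reflexive (cong G (ℕ.*-comm (suc q) k)))

    sparse-sum : ∀ n → sumTo n G ≈ sumTo (n / k) (λ i → G (k ℕ.* i))
    sparse-sum n = begin
      sumTo n G                       ≈⟨ reflexive (cong (λ z → sumTo z G) n≡qk+r) ⟩
      sumTo (n / k ℕ.* k ℕ.+ n % k) G ≈⟨ sum-tail (n / k) (n % k) (m%n<n n k) ⟩
      sumTo (n / k ℕ.* k) G           ≈⟨ sum-multiples (n / k) ⟩
      sumTo (n / k) (λ i → G (k ℕ.* i)) ∎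
      where
      open import Data.Nat.DivMod using (m≡m%n+[m/n]*n; m%n<n)
      n≡qk+r : n ≡ n / k ℕ.* k ℕ.+ n % k
      n≡qk+r = ≡.trans (m≡m%n+[m/n]*n n k) (ℕ.+-comm (n % k) _)

  1≉0 : ¬ (1# ≈ 0#)
  1≉0 1≈0 = char-zero 0 (trans (+-identityʳ 1#) 1≈0)

  inverse-of-one : ∀ y → y ≈ 1# → y ⁻¹ ≈ 1#
  inverse-of-one y y≈1 = begin
    y ⁻¹       ≈⟨ *-identityˡ _ ⟨
    1# * y ⁻¹  ≈⟨ *-congʳ y≈1 ⟨
    y * y ⁻¹   ≈⟨ ⁻¹-inverse y (λ y≈0 → 1≉0 (trans (sym y≈1) y≈0)) ⟩
    1#         ∎

  fallingF : ℕ → ℕ → Carrier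
  fallingF n N = prod1to N (λ t → ι (suc n) - ι t)

  fallingF≈cast : ∀ n N → fallingF n N ≈ ι (n P′ N)
  fallingF≈cast n zero = sym (+-identityʳ 1#)
  fallingF≈cast n (suc N) with N ℕ.≤? n
  ... | yes N≤n = begin
    fallingF n N * (ι (suc n) - ι (suc N)) ≈⟨ *-cong (fallingF≈cast n N) (cast-∸ n N N≤n) ⟩
    ι (n P′ N) * ι (n ∸ N)                ≈⟨ *-comm _ _ ⟩
    ι (n ∸ N) * ι (n P′ N)                ≈⟨ cast-* (n ∸ N) (n P′ N) ⟨
    ι ((n ∸ N) ℕ.* (n P′ N))              ∎
  ... | no N≰n = begin
    fallingF n N * (ι (suc n) - ι (suc N)) ≈⟨ *-congʳ (fallingF≈cast n N) ⟩
    ι (n P′ N) * (ι (suc n) - ι (suc N))  ≈⟨ *-congʳ (reflexive (cong ι vanishes)) ⟩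
    0# * (ι (suc n) - ι (suc N))          ≈⟨ zeroˡ _ ⟩
    0#                                    ≈⟨ reflexive (cong ι (≡.sym (≡.trans (cong ((n ∸ N) ℕ.*_) vanishes) (ℕ.*-zeroʳ (n ∸ N))))) ⟩
    ι ((n ∸ N) ℕ.* (n P′ N))              ∎
    where vanishes : n P′ N ≡ 0
          vanishes = falling-vanishes n N (ℕ.≰⇒> N≰n)

  module UpperParameters (k' : ℕ) where
    open import Algebra.Properties.Ring ring using (-‿distribˡ-*; -‿anti-homo-+; -‿involutive; x[y-z]≈xy-xz)
    open import Data.Nat.Combinatorics.Specification using (nP′n≡n!)
    open import Algebra.Properties.CommutativeSemigroup *-commutativeSemigroup using (x∙yz≈y∙xz)

    k : ℕ
    k = suc k'

    γ : Carrier
    γ = - (ι k ⁻¹)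

    k·k⁻¹≈1 : ι k * ι k ⁻¹ ≈ 1#
    k·k⁻¹≈1 = ⁻¹-inverse (ι k) (char-zero k')

    -- Raising the j-th upper parameter by l gives γ·(n+1 - (lk+j)): the
    -- shifted parameters run through γ·(n+1-t), t = 1, 2, …, interlaced.
    parameter-shift : ∀ n j l →
      - ((ι (suc n) - ι j) ÷ ι k) + ι l ≈ γ * (ι (suc n) - ι (l ℕ.* k ℕ.+ j))
    parameter-shift n j l = sym (begin
      γ * (a - ι (l ℕ.* k ℕ.+ j))  ≈⟨ *-congˡ (+-congˡ (-‿cong (trans (cast-+ (l ℕ.* k) j) (+-congʳ (cast-* l k))))) ⟩
      γ * (a - (L * K + b))        ≈⟨ *-congˡ regroup ⟩
      γ * ((a - b) - L * K)        ≈⟨ x[y-z]≈xy-xz γ (a - b) (L * K) ⟩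
      γ * (a - b) - γ * (L * K)    ≈⟨ +-cong scaled-difference (-‿cong (sym (-‿distribˡ-* w (L * K)))) ⟩
      - ((a - b) * w) - - (w * (L * K)) ≈⟨ +-congˡ (-‿involutive _) ⟩
      - ((a - b) * w) + w * (L * K) ≈⟨ +-congˡ w·LK≈L ⟩
      - ((a - b) * w) + L          ∎)
      where
      a = ι (suc n)
      b = ι j
      L = ι l
      K = ι k
      w = ι k ⁻¹
      regroup : a - (L * K + b) ≈ (a - b) - L * K
      regroup = trans (+-congˡ (-‿anti-homo-+ (L * K) b)) (sym (+-assoc a (- b) (- (L * K))))
      scaled-difference : γ * (a - b) ≈ - ((a - b) * w)
      scaled-difference = trans (sym (-‿distribˡ-* w (a - b))) (-‿cong (*-comm w (a - b)))
      w·LK≈L : w * (L * K) ≈ L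
      w·LK≈L = begin
        w * (L * K)  ≈⟨ *-comm w (L * K) ⟩
        L * K * w    ≈⟨ *-assoc L K w ⟩
        L * (K * w)  ≈⟨ *-congˡ k·k⁻¹≈1 ⟩
        L * 1#       ≈⟨ *-identityʳ L ⟩
        L            ∎

    upperProduct : ℕ → ℕ → Carrier
    upperProduct n i = prod1to k (λ j → rising (- ((ι (suc n) - ι j) ÷ ι k)) i)

    -- γ^{ki}, written as the product it arises as.
    scale : ℕ → Carrier
    scale i = prodBelow i (λ _ → prod1to k (λ _ → γ))

    upperProduct≈falling : ∀ n i → upperProduct n i ≈ scale i * fallingF n (i ℕ.* k)
    upperProduct≈falling n i = begin
      upperProduct n i
        ≈⟨ prod1to-cong k (λ j → trans (rising≈prodBelow _ i) (prodBelow-cong i (parameter-shift n j))) ⟩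
      prod1to k (λ j → prodBelow i (λ l → γ * G (l ℕ.* k ℕ.+ j)))
        ≈⟨ prod-interchange k i _ ⟩
      prodBelow i (λ l → prod1to k (λ j → γ * G (l ℕ.* k ℕ.+ j)))
        ≈⟨ prodBelow-cong i (λ l → prod1to-* k _ _) ⟩
      prodBelow i (λ l → prod1to k (λ _ → γ) * prod1to k (λ j → G (l ℕ.* k ℕ.+ j)))
        ≈⟨ prodBelow-* i _ _ ⟩
      scale i * prodBelow i (λ l → prod1to k (λ j → G (l ℕ.* k ℕ.+ j)))
        ≈⟨ *-congˡ (prod-blocks k i G) ⟩
      scale i * fallingF n (i ℕ.* k) ∎
      where
      G : ℕ → Carrier
      G t = ι (suc n) - ι t

    upperProduct≈cast : ∀ n i → upperProduct n i ≈ scale i * ι (n P′ (k ℕ.* i))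
    upperProduct≈cast n i = trans (upperProduct≈falling n i)
      (*-congˡ (trans (fallingF≈cast n (i ℕ.* k)) (reflexive (cong (λ N → ι (n P′ N)) (ℕ.*-comm i k)))))

    upperProduct-binomial : ∀ n i → upperProduct n i ≈ ι (n C (k ℕ.* i)) * upperProduct (k ℕ.* i) i
    upperProduct-binomial n i = begin
      upperProduct n i                   ≈⟨ upperProduct≈cast n i ⟩
      scale i * ι (n P′ N)               ≈⟨ *-congˡ (reflexive (cong ι (falling≡binomial*factorial n N))) ⟩
      scale i * ι ((n C N) ℕ.* N !)      ≈⟨ *-congˡ (cast-* (n C N) (N !)) ⟩
      scale i * (ι (n C N) * ι (N !))    ≈⟨ x∙yz≈y∙xz _ _ _ ⟩
      ι (n C N) * (scale i * ι (N !))    ≈⟨ *-congˡ (*-congˡ (reflexive (cong ι (≡.sym (nP′n≡n! N))))) ⟩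
      ι (n C N) * (scale i * ι (N P′ N)) ≈⟨ *-congˡ (upperProduct≈cast N i) ⟨
      ι (n C N) * upperProduct N i       ∎
      where
      N : ℕ
      N = k ℕ.* i

  module AppellCoefficients (k' : ℕ) {p q} (as : Vec Carrier p) (bs : Vec Carrier q) (m : ℕ) where
    open UpperParameters k'
    open import Algebra.Solver.CommutativeMonoid *-commutativeMonoid using (solve; _⊜_; _⊕_)

    ratio : ℕ → Carrier
    ratio i = prodVec (map (λ a → rising a i) as) ÷ prodVec (map (λ b → rising b i) bs)

    power : ℕ → Carrier
    power i = pow (ι m) i ÷ ι (i !)

    -- The part of the i-th term of A_{ki}^{(k)} that does not involve x;
    -- it will be the Appell coefficient α_{ki}.
    β : ℕ → Carrier
    β i = (ratio i * upperProduct (k ℕ.* i) i) * power i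

    -- atResidue r i: the coefficient at index ik + r.
    atResidue : ℕ → ℕ → Carrier
    atResidue zero    i = β i
    atResidue (suc _) _ = 0#

    α : ℕ → Carrier
    α j = atResidue (j % k) (j / k)

    α-multiple : ∀ i → α (k ℕ.* i) ≡ β i
    α-multiple i = cong₂ atResidue (≡.trans (cong (_% k) (ℕ.*-comm k i)) (m*n%n≡0 i k))
                                  (≡.trans (cong (_/ k) (ℕ.*-comm k i)) (m*n/n≡m i k))
      where open import Data.Nat.DivMod using (m*n%n≡0; m*n/n≡m)

    α-off : ∀ j r → j % k ≡ suc r → α j ≡ 0#
    α-off j r j%k≡1+r = cong (λ z → atResidue z (j / k)) j%k≡1+r

    risings-at-0 : ∀ {n} (v : Vec Carrier n) → prodVec (map (λ a → rising a 0) v) ≈ 1#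
    risings-at-0 []      = refl
    risings-at-0 (_ ∷ v) = trans (*-identityˡ _) (risings-at-0 v)

    β0≈1 : β 0 ≈ 1#
    β0≈1 = begin
      (ratio 0 * upperProduct 0 0) * power 0 ≈⟨ *-cong (*-cong ratio0≈1 (prod1to-1 k)) power0≈1 ⟩
      (1# * 1#) * 1#                         ≈⟨ trans (*-identityʳ _) (*-identityʳ 1#) ⟩
      1#                                     ∎
      where
      ratio0≈1 : ratio 0 ≈ 1#
      ratio0≈1 = trans (*-cong (risings-at-0 as) (inverse-of-one _ (risings-at-0 bs))) (*-identityˡ 1#)
      power0≈1 : power 0 ≈ 1#
      power0≈1 = trans (*-identityˡ _) (inverse-of-one _ (+-identityʳ 1#))

    α0≉0 : ¬ (α 0 ≈ 0#)
    α0≉0 α0≈0 = 1≉0 (trans (sym β0≈1) α0≈0)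

    term-matches : ∀ n x i →
      (ratio i * upperProduct n i) * (power i * pow x (n ∸ k ℕ.* i))
        ≈ (ι (n C (k ℕ.* i)) * α (k ℕ.* i)) * pow x (n ∸ k ℕ.* i)
    term-matches n x i = begin
      (ratio i * upperProduct n i) * (power i * X)
        ≈⟨ *-congʳ (*-congˡ (upperProduct-binomial n i)) ⟩
      (ratio i * (ι (n C (k ℕ.* i)) * upperProduct (k ℕ.* i) i)) * (power i * X)
        ≈⟨ rearrange (ratio i) (ι (n C (k ℕ.* i))) (upperProduct (k ℕ.* i) i) (power i) X ⟩
      (ι (n C (k ℕ.* i)) * β i) * X
        ≈⟨ *-congʳ (*-congˡ (reflexive (≡.sym (α-multiple i)))) ⟩
      (ι (n C (k ℕ.* i)) * α (k ℕ.* i)) * X ∎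
      where
      X : Carrier
      X = pow x (n ∸ k ℕ.* i)
      rearrange : ∀ Q C U M X → (Q * (C * U)) * (M * X) ≈ (C * ((Q * U) * M)) * X
      rearrange = solve 5 (λ Q C U M X → (Q ⊕ (C ⊕ U)) ⊕ (M ⊕ X) ⊜ (C ⊕ ((Q ⊕ U) ⊕ M)) ⊕ X) refl

    -- Only multiples of k contribute to the Appell sum, and those match
    -- the terms of A_n^{(k)} one by one.
    A≈appellCoeff : ∀ n x → A as bs k m n x ≈ appellCoeff α n x
    A≈appellCoeff n x = sym (begin
      sumTo n G                          ≈⟨ sparse-sum n ⟩
      sumTo (n / k) (λ i → G (k ℕ.* i))  ≈⟨ sumTo-cong (n / k) (λ i → sym (term-matches n x i)) ⟩
      A as bs k m n x                    ∎)
      where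
      G : ℕ → Carrier
      G j = (ι (n C j) * α j) * pow x (n ∸ j)
      G-off : ∀ j r → j % k ≡ suc r → G j ≈ 0#
      G-off j r j%k≡1+r =
        trans (*-congʳ (trans (*-congˡ (reflexive (α-off j r j%k≡1+r))) (zeroʳ _))) (zeroˡ _)
      open SparseSum k' G G-off using (sparse-sum)

theorem1 : ∀ {c ℓ} (F : CharZeroField c ℓ) →
    let open CharZeroField F
        open FieldOps F
    in (p q : ℕ) (as : Vec Carrier p) (bs : Vec Carrier q) →
       (∀ (s : Fin q) (j : ℕ) → ¬ (lookup bs s ≈ - ι j)) →
       (k : ℕ) → .{{_ : NonZero k}} → (m : ℕ) →
       Σ (ℕ → Carrier) λ α →
         ¬ (α 0 ≈ 0#) × (∀ (n : ℕ) (x : Carrier) → A as bs k m n x ≈ appellCoeff α n x)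
theorem1 F p q as bs _ (suc k') m = α , α0≉0 , A≈appellCoeff
  where open Development.AppellCoefficients F k' as bs m
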